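{- Let $k\ge2$, $X=\{x_1,\dots,x_n\}\subset\mathbb{R}^D$ distinct points, and consider a run of Algorithm 1 (described in the context) on $x_1,\dots,x_n$ with an offline approximation algorithm $A$, together with the sets $P_t,Q_t$ and the directed graph $G$ defined in the context. If $i_1<i_2<\dots<i_r$ is an independent set in $G$, then $x_{i_1},x_{i_2},\dots,x_{i_r}$ is a $(2,k)$-sequence.
   Context: Distances are Euclidean; $\mathcal{L}(S)=\sum_{x\in S}d(x,\mu_S)^2$ with $\mu_S$ the mean of $S$. An offline approximation algorithm $A$ outputs, for a finite input set, a partition into at most $k$ nonempty clusters. Algorithm 1: for $t=1,\dots,n$: run $A$ on $\{x_1,\dots,x_t\}$, obtaining nonempty clusters $C_t^1,\dots,C_t^{k_t}$ ($k_t\le k$); let $c_t^j$ be the mean of $C_t^j$; index so $d(c_t^1,x_t)\le\dots\le d(c_t^{k_t},x_t)$; $L_t=\sum_j\mathcal{L}(C_t^j)$; $v_t=\max\{i:\sum_{j=1}^i|C_t^j|d(c_t^j,c_t^i)^2\le100L_t\}$; $s_t=\sum_{j\le v_t}|C_t^j|$; add $x_t$ to the output with probability $\min(1,20k\ln k/s_t)$. Define $P_t=C_t^1\cup\dots\cup C_t^{v_t}$; $r_t=d(x_t,c_t^{v_t+1})$ if $v_t<k_t$ and $r_t=+\infty$ if $v_t=k_t$; for $x\in\{x_1,\dots,x_t\}$ let $a_t(x)=c_t^j$ where $x\in C_t^j$; $Q_t=\{x\in\{x_1,\dots,x_t\}\setminus P_t: d(x,a_t(x))\ge r_t/5\}$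 (empty if $r_t=\infty$). $G$ is the directed graph on vertex set $\{1,\dots,n\}$ with edge set $\{(j,i): x_i\in P_j\cup Q_j\}$ (loops allowed). An independent set is a set $I$ of vertices such that there is no edge $(a,b)$ with $a\ne b$ and $a,b\in I$. For $\beta>1$: $\mathrm{diam}(P)=\max_{x,y\in P}d(x,y)$ (0 for at most one point), $\mathrm{diam}_\ell(P)$ is the minimum over partitions of $P$ into at most $\ell$ parts of the largest part diameter, and a $(\beta,k)$-sequence is a sequence $y_1,\dots,y_m$ with $\min_{i<j}d(y_i,y_j)>\beta\,\mathrm{diam}_{k-1}(\{y_1,\dots,y_{j-1}\})$ for all $1<j\le m$. -}

module Defs where

open import Data.Nat as ℕ using (ℕ; zero; suc; _∸_)
open import Data.Fin as Fin using (Fin; toℕ; inject)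
open import Data.Fin.Properties as FinP using ()
open import Data.Product using (Σ; ∃; ∃-syntax; _×_; _,_)
open import Data.Sum using (_⊎_)
open import Relation.Nullary using (¬_; Dec; yes; no)
open import Relation.Nullary.Decidable using (_×-dec_)
open import Relation.Binary.PropositionalEquality using (_≡_; _≢_)
open import Relation.Binary.Structures using (IsTotalOrder)
open import Algebra.Structures using (IsCommutativeRing)
open import Function using (_∘_)

-- An abstract model of the real numbers: a complete ordered field.
-- (All complete ordered fields are isomorphic to ℝ, so quantifying over
-- every model is quantifying over ℝ.)

record RealField : Set₁ where
  infixl 6 _+_ _-_
  infixl 7 _*_
  infix  8 -_ _⁻¹
  infix  4 _≤_ _<_
  field
    Carrier : Set
    _+_ _*_ : Carrier → Carrier → Carrier
    -_ _⁻¹  : Carrier → Carrier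
    0# 1#   : Carrier
    _≤_     : Carrier → Carrier → Set
    isCommutativeRing : IsCommutativeRing _≡_ _+_ _*_ -_ 0# 1#
    ⁻¹-inverse   : ∀ x → x ≢ 0# → x * x ⁻¹ ≡ 1#
    0≢1          : 0# ≢ 1#
    isTotalOrder : IsTotalOrder _≡_ _≤_
    +-mono-≤     : ∀ {x y} z → x ≤ y → x + z ≤ y + z
    *-nonneg     : ∀ {x y} → 0# ≤ x → 0# ≤ y → 0# ≤ x * y
    complete     : (S : Carrier → Set) → ∃ S → (∃ λ b → ∀ x → S x → x ≤ b) →
                   ∃ λ s → (∀ x → S x → x ≤ s) × (∀ b → (∀ x → S x → x ≤ b) → s ≤ b)

  _-_ : Carrier → Carrier → Carrier
  x - y = x + (- y)

  _<_ : Carrier → Carrier → Set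
  x < y = (x ≤ y) × (x ≢ y)

  fromℕ : ℕ → Carrier
  fromℕ zero    = 0#
  fromℕ (suc n) = 1# + fromℕ n

module _ (R : RealField) where
  open RealField R

  Point : ℕ → Set
  Point D = Fin D → Carrier

  ∑ : (m : ℕ) → (Fin m → Carrier) → Carrier
  ∑ zero    f = 0#
  ∑ (suc m) f = f Fin.zero + ∑ m (f ∘ Fin.suc)

  dist² : {D : ℕ} → Point D → Point D → Carrier
  dist² {D} p q = ∑ D (λ i → (p i - q i) * (p i - q i))

  ite : {P : Set} → Dec P → Carrier → Carrier
  ite (yes _) a = a
  ite (no _)  _ = 0#

  -- Quantities of step t of Algorithm 1, given the output of A on
  -- {x_0,…,x_t} as a cluster assignment asg : Fin n → Fin m (only values
  -- on indices u ≤ t matter).  Indices are 0-based.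
  module Step {n D : ℕ} (x : Fin n → Point D) (t : Fin n) {m : ℕ} (asg : Fin n → Fin m) where

    InC : Fin m → Fin n → Set
    InC j u = (u Fin.≤ t) × (asg u ≡ j)

    inC? : ∀ j u → Dec (InC j u)
    inC? j u = (u FinP.≤? t) ×-dec (asg u FinP.≟ j)

    size : Fin m → Carrier
    size j = ∑ n (λ u → ite (inC? j u) 1#)

    centre : Fin m → Point D
    centre j d = size j ⁻¹ * ∑ n (λ u → ite (inC? j u) (x u d))

    cost : Carrier
    cost = ∑ n (λ u → ite (u FinP.≤? t) (dist² (x u) (centre (asg u))))

    vsum : Fin m → Carrier
    vsum i = ∑ m (λ j → ite (j FinP.≤? i) (size j * dist² (centre j) (centre i)))

    Good : Fin m → Set
    Good i = vsum i ≤ fromℕ 100 * cost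

    IsV : Fin m → Set
    IsV v = Good v × (∀ i → Good i → i Fin.≤ v)

    InP : Fin n → Set
    InP u = (u Fin.≤ t) × (∃[ v ] (IsV v × (asg u Fin.≤ v)))

    -- x_u ∈ Q_t :  d(x_u, a_t(x_u)) ≥ r_t / 5 with r_t = d(x_t, c_t^{v_t+1}),
    -- written as 25·d(x_u,a_t(x_u))^2 ≥ d(x_t,c_t^{v_t+1})^2 (both sides ≥ 0);
    -- empty when v_t is the last index (r_t = ∞).
    InQ : Fin n → Set
    InQ u = (u Fin.≤ t) × (¬ InP u) ×
            (∃[ v ] (IsV v × (∃[ w ] ((toℕ w ≡ suc (toℕ v)) ×
              (dist² (x t) (centre w) ≤ fromℕ 25 * dist² (x u) (centre (asg u)))))))

  -- A run of Algorithm 1: at each step t the offline algorithm A returns a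
  -- partition of {x_0,…,x_t} into k_t ≤ k nonempty clusters, indexed in
  -- nondecreasing order of distance of their means to x_t.
  record Run (k n D : ℕ) (x : Fin n → Point D) : Set where
    field
      kt       : Fin n → ℕ
      kt≤k     : ∀ t → kt t ℕ.≤ k
      asg      : (t : Fin n) → Fin n → Fin (kt t)
      nonempty : ∀ t j → ∃[ u ] Step.InC x t (asg t) j u
      sorted   : ∀ t (j j' : Fin (kt t)) → j Fin.≤ j' →
                 dist² (Step.centre x t (asg t) j) (x t) ≤ dist² (Step.centre x t (asg t) j') (x t)

  Edge : {k n D : ℕ} {x : Fin n → Point D} → Run k n D x → Fin n → Fin n → Set
  Edge {x = x} ρ j i = Step.InP x j (Run.asg ρ j) i ⊎ Step.InQ x j (Run.asg ρ j) i

  IndependentSeq : {k n D : ℕ} {x : Fin n → Point D} → Run k n D x → {r : ℕ} → (Fin r → Fin n) → Set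
  IndependentSeq ρ {r} idx =
    (∀ a b → a Fin.< b → idx a Fin.< idx b) ×
    (∀ a b → idx a ≢ idx b → ¬ Edge ρ (idx a) (idx b))

  -- e = diam_ℓ(P)^2 for the family P = y : the minimum over partitions of P
  -- into at most ℓ parts (labelings f) of the largest squared part diameter.
  PartBound : {D m : ℕ} → (Fin m → Point D) → {ℓ : ℕ} → (Fin m → Fin ℓ) → Carrier → Set
  PartBound y f e = ∀ a b → f a ≡ f b → dist² (y a) (y b) ≤ e

  IsDiam² : (ℓ : ℕ) {D m : ℕ} → (Fin m → Point D) → Carrier → Set
  IsDiam² ℓ y e = (∃[ f ] PartBound y {ℓ} f e) × (∀ (f : _ → Fin ℓ) e' → PartBound y f e' → e ≤ e')

  -- (β,k)-sequence: for every j > 1 (0-based: toℕ j ≥ 1) and every i < j,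
  -- d(y_i,y_j) > β·diam_{k-1}(y_1..y_{j-1}), written with squares (β ≥ 0).
  BetaKSeq : Carrier → ℕ → {D m : ℕ} → (Fin m → Point D) → Set
  BetaKSeq β k {m = m} y =
    ∀ (j : Fin m) → 0 ℕ.< toℕ j → ∀ e → IsDiam² (k ∸ 1) (λ a → y (inject {i = j} a)) e →
    ∀ (i : Fin m) → i Fin.< j → β * β * e < dist² (y i) (y j)

-- Fix a position j, put t = i_j, and let x range over the earlier points x_{i_a}, a < j.  None of
-- them is joined to t, so x ∉ P_t puts x in a cluster beyond v_t, and then a cluster v_t + 1 exists;
-- x ∉ Q_t gives 25 d(x, a_t(x))² < d(x_t, c_t^{v_t+1})².  Grouping the earlier points by their
-- cluster uses at most k - 1 groups, so diam_{k-1}² ≤ 4M with M the largest d(x, a_t(x))².  As the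
-- clusters are sorted by distance to x_t, d(x_t, c_t^{v_t+1}) ≤ d(x_t, a_t(x)), and the relaxed
-- triangle inequality 4|u + w|² ≤ 5|u|² + 20|w|² turns d(x, x_t)² ≤ 4 diam_{k-1}² into
-- d(x_t, c_t^{v_t+1})² ≤ 25M, a contradiction.
module Submission where

open import Defs
open import Data.Nat using (ℕ; _≤_)
open import Data.Fin using (Fin)
open import Relation.Binary.PropositionalEquality using (_≡_)
open import Function using (_∘_)

open import Data.Nat as ℕ using (zero; suc; _∸_; z≤n; s≤s)
import Data.Nat.Properties as ℕP
open import Data.Integer as ℤ using (ℤ; -[1+_]) renaming (+_ to pos)
import Data.Integer.Properties as ℤP
open import Data.Integer.Base using (+-*-rawRing)
open import Data.Fin as Fin using (toℕ; inject; fromℕ<)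
import Data.Fin.Properties as FinP
open import Data.Maybe using (Maybe; just; nothing)
open import Data.Product using (_×_; _,_; ∃; proj₁; proj₂)
open import Data.Sum using (inj₁; inj₂)
open import Data.Empty using (⊥-elim)
open import Relation.Nullary using (¬_; Dec; yes; no)
open import Relation.Nullary.Decidable using (¬¬-excluded-middle)
open import Relation.Binary.PropositionalEquality
  using (_≢_; refl; sym; trans; cong; cong₂; subst; subst₂; module ≡-Reasoning)
open import Relation.Binary.Bundles using (Poset)
open import Relation.Binary.Structures using (IsTotalOrder)
open import Algebra using (CommutativeRing)
import Algebra.Properties.Ring as RingProperties
open import Algebra.Solver.Ring.AlmostCommutativeRing
  using (fromCommutativeRing; _-Raw-AlmostCommutative⟶_)

-- The unique ring morphism ℤ → R, which lets the ring solver use integer constants.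
module IntegerRingSolver (R : RealField) where
  open RealField R
  open ≡-Reasoning

  commutativeRing : CommutativeRing _ _
  commutativeRing = record { isCommutativeRing = isCommutativeRing }

  open CommutativeRing commutativeRing public
    using ( +-assoc; +-comm; +-identityˡ; +-identityʳ
          ; *-identityˡ; distribˡ; distribʳ; zeroˡ; zeroʳ; -‿inverseʳ)
  open RingProperties (CommutativeRing.ring commutativeRing) public
    using (-‿distribˡ-*; -‿distribʳ-*; -‿involutive; -0#≈0#; -‿+-comm)

  ⟦_⟧ℤ : ℤ → Carrier
  ⟦ pos n ⟧ℤ    = fromℕ n
  ⟦ -[1+ n ] ⟧ℤ = - fromℕ (suc n)

  fromℕ-+ : ∀ m n → fromℕ (m ℕ.+ n) ≡ fromℕ m + fromℕ n
  fromℕ-+ zero    n = sym (+-identityˡ _)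
  fromℕ-+ (suc m) n = trans (cong (1# +_) (fromℕ-+ m n)) (sym (+-assoc 1# _ _))

  fromℕ-* : ∀ m n → fromℕ (m ℕ.* n) ≡ fromℕ m * fromℕ n
  fromℕ-* zero    n = sym (zeroˡ _)
  fromℕ-* (suc m) n = begin
    fromℕ (n ℕ.+ m ℕ.* n)             ≡⟨ fromℕ-+ n (m ℕ.* n) ⟩
    fromℕ n + fromℕ (m ℕ.* n)          ≡⟨ cong₂ _+_ (sym (*-identityˡ _)) (fromℕ-* m n) ⟩
    1# * fromℕ n + fromℕ m * fromℕ n   ≡⟨ sym (distribʳ _ _ _) ⟩
    (1# + fromℕ m) * fromℕ n           ∎

  fromℕ-⊖ : ∀ m n → ⟦ m ℤ.⊖ n ⟧ℤ ≡ fromℕ m - fromℕ n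
  fromℕ-⊖ m zero = begin
    ⟦ m ℤ.⊖ 0 ⟧ℤ   ≡⟨ cong ⟦_⟧ℤ (ℤP.⊖-≥ {m} {0} ℕ.z≤n) ⟩
    fromℕ m        ≡⟨ sym (+-identityʳ _) ⟩
    fromℕ m + 0#   ≡⟨ cong (fromℕ m +_) (sym -0#≈0#) ⟩
    fromℕ m - 0#   ∎
  fromℕ-⊖ zero (suc n) =
    trans (cong ⟦_⟧ℤ (ℤP.⊖-< {0} {suc n} (ℕ.s≤s ℕ.z≤n))) (sym (+-identityˡ _))
  fromℕ-⊖ (suc m) (suc n) = begin
    ⟦ suc m ℤ.⊖ suc n ⟧ℤ             ≡⟨ cong ⟦_⟧ℤ (ℤP.[1+m]⊖[1+n]≡m⊖n m n) ⟩
    ⟦ m ℤ.⊖ n ⟧ℤ                     ≡⟨ fromℕ-⊖ m n ⟩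
    fromℕ m - fromℕ n                ≡⟨ cong (_- fromℕ n) (sym (+-identityˡ _)) ⟩
    (0# + fromℕ m) - fromℕ n         ≡⟨ cong (λ z → (z + fromℕ m) - fromℕ n) (sym (-‿inverseʳ 1#)) ⟩
    ((1# - 1#) + fromℕ m) - fromℕ n  ≡⟨ cong (_- fromℕ n) (+-assoc 1# (- 1#) _) ⟩
    (1# + (- 1# + fromℕ m)) - fromℕ n ≡⟨ cong (λ z → (1# + z) - fromℕ n) (+-comm (- 1#) _) ⟩
    (1# + (fromℕ m - 1#)) - fromℕ n  ≡⟨ cong (_- fromℕ n) (sym (+-assoc 1# _ _)) ⟩
    ((1# + fromℕ m) - 1#) - fromℕ n  ≡⟨ +-assoc (1# + fromℕ m) _ _ ⟩
    (1# + fromℕ m) + (- 1# - fromℕ n) ≡⟨ cong ((1# + fromℕ m) +_) (-‿+-comm 1# (fromℕ n)) ⟩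
    fromℕ (suc m) - fromℕ (suc n)    ∎

  ⟦-⟧ℤ : ∀ i → ⟦ ℤ.- i ⟧ℤ ≡ - ⟦ i ⟧ℤ
  ⟦-⟧ℤ (pos zero)    = sym -0#≈0#
  ⟦-⟧ℤ (pos (suc n)) = refl
  ⟦-⟧ℤ -[1+ n ]      = sym (-‿involutive _)

  ⟦+⟧ℤ : ∀ i j → ⟦ i ℤ.+ j ⟧ℤ ≡ ⟦ i ⟧ℤ + ⟦ j ⟧ℤ
  ⟦+⟧ℤ -[1+ m ] -[1+ n ] = begin
    - fromℕ (suc (suc (m ℕ.+ n)))      ≡⟨ cong (λ z → - fromℕ (suc z)) (sym (ℕP.+-suc m n)) ⟩
    - fromℕ (suc m ℕ.+ suc n)          ≡⟨ cong -_ (fromℕ-+ (suc m) (suc n)) ⟩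
    - (fromℕ (suc m) + fromℕ (suc n))  ≡⟨ sym (-‿+-comm _ _) ⟩
    - fromℕ (suc m) - fromℕ (suc n)    ∎
  ⟦+⟧ℤ -[1+ m ] (pos n) = trans (fromℕ-⊖ n (suc m)) (+-comm _ _)
  ⟦+⟧ℤ (pos m) -[1+ n ] = fromℕ-⊖ m (suc n)
  ⟦+⟧ℤ (pos m) (pos n)  = fromℕ-+ m n

  ⟦*⟧ℤ : ∀ i j → ⟦ i ℤ.* j ⟧ℤ ≡ ⟦ i ⟧ℤ * ⟦ j ⟧ℤ
  ⟦*⟧ℤ (pos m) (pos n) = trans (cong ⟦_⟧ℤ (ℤP.+◃n≡+n (m ℕ.* n))) (fromℕ-* m n)
  ⟦*⟧ℤ (pos m) -[1+ n ] = begin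
    ⟦ pos m ℤ.* -[1+ n ] ⟧ℤ      ≡⟨ cong ⟦_⟧ℤ (ℤP.-◃n≡-n (m ℕ.* suc n)) ⟩
    ⟦ ℤ.- pos (m ℕ.* suc n) ⟧ℤ   ≡⟨ ⟦-⟧ℤ (pos (m ℕ.* suc n)) ⟩
    - fromℕ (m ℕ.* suc n)        ≡⟨ cong -_ (fromℕ-* m (suc n)) ⟩
    - (fromℕ m * fromℕ (suc n))  ≡⟨ -‿distribʳ-* _ _ ⟩
    fromℕ m * - fromℕ (suc n)    ∎
  ⟦*⟧ℤ -[1+ m ] (pos n) = begin
    ⟦ -[1+ m ] ℤ.* pos n ⟧ℤ      ≡⟨ cong ⟦_⟧ℤ (ℤP.-◃n≡-n (suc m ℕ.* n)) ⟩
    ⟦ ℤ.- pos (suc m ℕ.* n) ⟧ℤ   ≡⟨ ⟦-⟧ℤ (pos (suc m ℕ.* n)) ⟩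
    - fromℕ (suc m ℕ.* n)        ≡⟨ cong -_ (fromℕ-* (suc m) n) ⟩
    - (fromℕ (suc m) * fromℕ n)  ≡⟨ -‿distribˡ-* _ _ ⟩
    - fromℕ (suc m) * fromℕ n    ∎
  ⟦*⟧ℤ -[1+ m ] -[1+ n ] = begin
    ⟦ -[1+ m ] ℤ.* -[1+ n ] ⟧ℤ        ≡⟨ cong ⟦_⟧ℤ (ℤP.+◃n≡+n (suc m ℕ.* suc n)) ⟩
    fromℕ (suc m ℕ.* suc n)          ≡⟨ fromℕ-* (suc m) (suc n) ⟩
    fromℕ (suc m) * fromℕ (suc n)    ≡⟨ sym (-‿involutive _) ⟩
    - - (fromℕ (suc m) * fromℕ (suc n)) ≡⟨ cong -_ (-‿distribʳ-* _ _) ⟩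
    - (fromℕ (suc m) * - fromℕ (suc n)) ≡⟨ -‿distribˡ-* _ _ ⟩
    - fromℕ (suc m) * - fromℕ (suc n) ∎

  ℤ⟶R : +-*-rawRing -Raw-AlmostCommutative⟶ fromCommutativeRing commutativeRing
  ℤ⟶R = record
    { ⟦_⟧ = ⟦_⟧ℤ ; +-homo = ⟦+⟧ℤ ; *-homo = ⟦*⟧ℤ ; -‿homo = ⟦-⟧ℤ
    ; 0-homo = refl ; 1-homo = +-identityʳ 1# }

  ⟦⟧ℤ-≟ : ∀ i j → Maybe (⟦ i ⟧ℤ ≡ ⟦ j ⟧ℤ)
  ⟦⟧ℤ-≟ i j with i ℤ.≟ j
  ... | yes i≡j = just (cong ⟦_⟧ℤ i≡j)
  ... | no _    = nothing

  open import Algebra.Solver.Ring +-*-rawRing (fromCommutativeRing commutativeRing) ℤ⟶R ⟦⟧ℤ-≟ public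

module OrderProperties (R : RealField) where
  open RealField R renaming (_≤_ to _≤ℝ_; _<_ to _<ℝ_; +-mono-≤ to +-monoˡ-≤)
  open IntegerRingSolver R
  open IsTotalOrder isTotalOrder public using (total; antisym) renaming (refl to ≤-refl; trans to ≤-trans)

  poset : Poset _ _ _
  poset = record { isPartialOrder = IsTotalOrder.isPartialOrder isTotalOrder }

  open import Relation.Binary.Reasoning.PartialOrder poset public

  ≤-reflexive : ∀ {a b} → a ≡ b → a ≤ℝ b
  ≤-reflexive refl = ≤-refl

  ≰⇒> : ∀ {a b} → ¬ (b ≤ℝ a) → a <ℝ b
  ≰⇒> {a} {b} b≰a with total a b
  ... | inj₁ a≤b = a≤b , λ { refl → b≰a ≤-refl }
  ... | inj₂ b≤a = ⊥-elim (b≰a b≤a)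

  <⇒≱ : ∀ {a b} → a <ℝ b → ¬ (b ≤ℝ a)
  <⇒≱ (a≤b , a≢b) b≤a = a≢b (antisym a≤b b≤a)

  +-mono-≤ : ∀ {a b c d} → a ≤ℝ b → c ≤ℝ d → a + c ≤ℝ b + d
  +-mono-≤ {a} {b} {c} {d} a≤b c≤d = begin
    a + c  ≤⟨ +-monoˡ-≤ c a≤b ⟩
    b + c  ≡⟨ +-comm b c ⟩
    c + b  ≤⟨ +-monoˡ-≤ b c≤d ⟩
    d + b  ≡⟨ +-comm d b ⟩
    b + d  ∎

  ≤⇒0≤- : ∀ {a b} → a ≤ℝ b → 0# ≤ℝ b - a
  ≤⇒0≤- {a} {b} a≤b = begin
    0#     ≡⟨ sym (-‿inverseʳ a) ⟩
    a - a  ≤⟨ +-monoˡ-≤ (- a) a≤b ⟩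
    b - a  ∎

  0≤-⇒≤ : ∀ {a b} → 0# ≤ℝ b - a → a ≤ℝ b
  0≤-⇒≤ {a} {b} 0≤b-a = begin
    a             ≡⟨ sym (+-identityˡ a) ⟩
    0# + a        ≤⟨ +-monoˡ-≤ a 0≤b-a ⟩
    (b - a) + a   ≡⟨ solve 2 (λ a b → (b :- a) :+ a := b) refl a b ⟩
    b             ∎

  x*x-nonneg : ∀ a → 0# ≤ℝ a * a
  x*x-nonneg a with total 0# a
  ... | inj₁ 0≤a = *-nonneg 0≤a 0≤a
  ... | inj₂ a≤0 = begin
    0#         ≤⟨ *-nonneg 0≤-a 0≤-a ⟩
    - a * - a  ≡⟨ solve 1 (λ a → (:- a) :* (:- a) := a :* a) refl a ⟩
    a * a      ∎
    where
    0≤-a : 0# ≤ℝ - a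
    0≤-a = ≤-trans (≤⇒0≤- a≤0) (≤-reflexive (+-identityˡ (- a)))

  ≤-+-square : ∀ a h → a ≤ℝ a + h * h
  ≤-+-square a h = begin
    a          ≡⟨ sym (+-identityʳ a) ⟩
    a + 0#     ≤⟨ +-mono-≤ ≤-refl (x*x-nonneg h) ⟩
    a + h * h  ∎

  0≤1 : 0# ≤ℝ 1#
  0≤1 = ≤-trans (x*x-nonneg 1#) (≤-reflexive (*-identityˡ 1#))

  fromℕ-nonneg : ∀ n → 0# ≤ℝ fromℕ n
  fromℕ-nonneg zero    = ≤-refl
  fromℕ-nonneg (suc n) = begin
    0#            ≡⟨ sym (+-identityʳ 0#) ⟩
    0# + 0#       ≤⟨ +-mono-≤ 0≤1 (fromℕ-nonneg n) ⟩
    1# + fromℕ n  ∎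

  fromℕ-suc≢0 : ∀ n → fromℕ (suc n) ≢ 0#
  fromℕ-suc≢0 n 1+n≡0 = 0≢1 (antisym 0≤1 1≤0)
    where
    1≤0 : 1# ≤ℝ 0#
    1≤0 = begin
      1#             ≡⟨ sym (+-identityʳ 1#) ⟩
      1# + 0#        ≤⟨ +-mono-≤ ≤-refl (fromℕ-nonneg n) ⟩
      fromℕ (suc n)  ≡⟨ 1+n≡0 ⟩
      0#             ∎

  *-monoʳ-≤-nonneg : ∀ {c a b} → 0# ≤ℝ c → a ≤ℝ b → c * a ≤ℝ c * b
  *-monoʳ-≤-nonneg {c} {a} {b} 0≤c a≤b = 0≤-⇒≤ (begin
    0#             ≤⟨ *-nonneg 0≤c (≤⇒0≤- a≤b) ⟩
    c * (b - a)    ≡⟨ solve 3 (λ c a b → c :* (b :- a) := c :* b :- c :* a) refl c a b ⟩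
    c * b - c * a  ∎)

  ⁻¹-*-cancelˡ : ∀ {c} → c ≢ 0# → ∀ a → c ⁻¹ * (c * a) ≡ a
  ⁻¹-*-cancelˡ {c} c≢0 a = begin-equality
    c ⁻¹ * (c * a)  ≡⟨ solve 3 (λ c c⁻¹ a → c⁻¹ :* (c :* a) := (c :* c⁻¹) :* a) refl c (c ⁻¹) a ⟩
    (c * c ⁻¹) * a  ≡⟨ cong (_* a) (⁻¹-inverse c c≢0) ⟩
    1# * a          ≡⟨ *-identityˡ a ⟩
    a               ∎

  *-cancelˡ-≤-pos : ∀ {c a b} → 0# ≤ℝ c → c ≢ 0# → c * a ≤ℝ c * b → a ≤ℝ b
  *-cancelˡ-≤-pos {c} {a} {b} 0≤c c≢0 ca≤cb with total a b
  ... | inj₁ a≤b = a≤b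
  ... | inj₂ b≤a = ≤-reflexive (begin-equality
    a               ≡⟨ ⁻¹-*-cancelˡ c≢0 a ⟨
    c ⁻¹ * (c * a)  ≡⟨ cong (c ⁻¹ *_) (antisym ca≤cb (*-monoʳ-≤-nonneg 0≤c b≤a)) ⟩
    c ⁻¹ * (c * b)  ≡⟨ ⁻¹-*-cancelˡ c≢0 b ⟩
    b               ∎)

  argmax : ∀ {m} → Fin m → (f : Fin m → Carrier) → ∃ λ a → ∀ b → f b ≤ℝ f a
  argmax {suc zero}    _ f = Fin.zero , λ { Fin.zero → ≤-refl }
  argmax {suc (suc m)} _ f with argmax Fin.zero (f ∘ Fin.suc)
  ... | a , a-max with total (f Fin.zero) (f (Fin.suc a))
  ...   | inj₁ f₀≤fa = Fin.suc a , λ { Fin.zero → f₀≤fa ; (Fin.suc b) → a-max b }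
  ...   | inj₂ fa≤f₀ = Fin.zero , λ { Fin.zero → ≤-refl ; (Fin.suc b) → ≤-trans (a-max b) fa≤f₀ }

module SumProperties (R : RealField) where
  open RealField R renaming (_≤_ to _≤ℝ_; _<_ to _<ℝ_; +-mono-≤ to +-monoˡ-≤)
  open IntegerRingSolver R
  open OrderProperties R

  ∑-cong : ∀ m {f g : Fin m → Carrier} → (∀ i → f i ≡ g i) → ∑ R m f ≡ ∑ R m g
  ∑-cong zero    f≡g = refl
  ∑-cong (suc m) f≡g = cong₂ _+_ (f≡g Fin.zero) (∑-cong m (f≡g ∘ Fin.suc))

  ∑-mono-≤ : ∀ m {f g : Fin m → Carrier} → (∀ i → f i ≤ℝ g i) → ∑ R m f ≤ℝ ∑ R m g
  ∑-mono-≤ zero    f≤g = ≤-refl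
  ∑-mono-≤ (suc m) f≤g = +-mono-≤ (f≤g Fin.zero) (∑-mono-≤ m (f≤g ∘ Fin.suc))

  ∑-zero : ∀ m → ∑ R m (λ _ → 0#) ≡ 0#
  ∑-zero zero    = refl
  ∑-zero (suc m) = trans (cong (0# +_) (∑-zero m)) (+-identityˡ 0#)

  ∑-nonneg : ∀ m {f : Fin m → Carrier} → (∀ i → 0# ≤ℝ f i) → 0# ≤ℝ ∑ R m f
  ∑-nonneg m 0≤f = ≤-trans (≤-reflexive (sym (∑-zero m))) (∑-mono-≤ m 0≤f)

  ∑-+ : ∀ m (f g : Fin m → Carrier) → ∑ R m (λ i → f i + g i) ≡ ∑ R m f + ∑ R m g
  ∑-+ zero    f g = sym (+-identityˡ 0#)
  ∑-+ (suc m) f g = begin-equality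
    (f₀ + g₀) + ∑ R m (λ i → f (Fin.suc i) + g (Fin.suc i))
      ≡⟨ cong ((f₀ + g₀) +_) (∑-+ m (f ∘ Fin.suc) (g ∘ Fin.suc)) ⟩
    (f₀ + g₀) + (∑ R m (f ∘ Fin.suc) + ∑ R m (g ∘ Fin.suc))
      ≡⟨ solve 4 (λ f₀ g₀ F G → (f₀ :+ g₀) :+ (F :+ G) := (f₀ :+ F) :+ (g₀ :+ G)) refl f₀ g₀ _ _ ⟩
    (f₀ + ∑ R m (f ∘ Fin.suc)) + (g₀ + ∑ R m (g ∘ Fin.suc))  ∎
    where
    f₀ g₀ : Carrier
    f₀ = f Fin.zero
    g₀ = g Fin.zero

  ∑-distribˡ : ∀ m α (f : Fin m → Carrier) → ∑ R m (λ i → α * f i) ≡ α * ∑ R m f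
  ∑-distribˡ zero    α f = sym (zeroʳ α)
  ∑-distribˡ (suc m) α f =
    trans (cong (α * f Fin.zero +_) (∑-distribˡ m α (f ∘ Fin.suc))) (sym (distribˡ α _ _))

  ite-nonneg : ∀ {P : Set} (P? : Dec P) {a} → 0# ≤ℝ a → 0# ≤ℝ ite R P? a
  ite-nonneg (yes _) 0≤a = 0≤a
  ite-nonneg (no _)  _   = ≤-refl

  ite-zero : ∀ {P : Set} (P? : Dec P) {a} → (P → a ≡ 0#) → ite R P? a ≡ 0#
  ite-zero (yes p) a≡0 = a≡0 p
  ite-zero (no _)  _   = refl

module DistanceProperties (R : RealField) where
  open RealField R renaming (_≤_ to _≤ℝ_; _<_ to _<ℝ_; +-mono-≤ to +-monoˡ-≤)
  open IntegerRingSolver R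
  open OrderProperties R
  open SumProperties R

  module _ {D : ℕ} where
    dist²-nonneg : ∀ (p q : Point R D) → 0# ≤ℝ dist² R p q
    dist²-nonneg p q = ∑-nonneg D (λ i → x*x-nonneg _)

    dist²-self : ∀ (p : Point R D) → dist² R p p ≡ 0#
    dist²-self p = trans (∑-cong D (λ i →
      solve 1 (λ a → (a :- a) :* (a :- a) := con (pos 0)) refl (p i))) (∑-zero D)

    dist²-sym : ∀ (p q : Point R D) → dist² R p q ≡ dist² R q p
    dist²-sym p q = ∑-cong D (λ i →
      solve 2 (λ a b → (a :- b) :* (a :- b) := (b :- a) :* (b :- a)) refl (p i) (q i))

    -- The relaxed triangle inequality |u + w|² ≤ (1 + λ)|u|² + (1 + 1/λ)|w|² for λ = q/p,
    -- scaled by pq; the gap is the square (q u - p w)².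
    dist²-triangle-weighted : ∀ p q (a b c : Point R D) →
      fromℕ (p ℕ.* q) * dist² R a b ≤ℝ
      fromℕ (q ℕ.* (p ℕ.+ q)) * dist² R a c + fromℕ (p ℕ.* (p ℕ.+ q)) * dist² R c b
    dist²-triangle-weighted p q a b c
      rewrite fromℕ-* p q | fromℕ-* q (p ℕ.+ q) | fromℕ-* p (p ℕ.+ q) | fromℕ-+ p q = begin
      P * Q * ∑ R D (λ i → sq (a i - b i))
        ≡⟨ ∑-distribˡ D (P * Q) _ ⟨
      ∑ R D (λ i → P * Q * sq (a i - b i))
        ≤⟨ ∑-mono-≤ D (λ i → ≤-trans (≤-+-square _ (Q * (a i - c i) - P * (c i - b i)))
                                      (≤-reflexive (gap (a i) (b i) (c i)))) ⟩
      ∑ R D (λ i → Q * (P + Q) * sq (a i - c i) + P * (P + Q) * sq (c i - b i))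
        ≡⟨ ∑-+ D _ _ ⟩
      ∑ R D (λ i → Q * (P + Q) * sq (a i - c i)) + ∑ R D (λ i → P * (P + Q) * sq (c i - b i))
        ≡⟨ cong₂ _+_ (∑-distribˡ D (Q * (P + Q)) _) (∑-distribˡ D (P * (P + Q)) _) ⟩
      Q * (P + Q) * dist² R a c + P * (P + Q) * dist² R c b  ∎
      where
      P Q : Carrier
      P = fromℕ p
      Q = fromℕ q
      sq : Carrier → Carrier
      sq z = z * z
      gap : ∀ a b c → P * Q * sq (a - b) + sq (Q * (a - c) - P * (c - b)) ≡
                      Q * (P + Q) * sq (a - c) + P * (P + Q) * sq (c - b)
      gap = solve 5 (λ P Q a b c →
        P :* Q :* ((a :- b) :* (a :- b))
          :+ (Q :* (a :- c) :- P :* (c :- b)) :* (Q :* (a :- c) :- P :* (c :- b))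
          := Q :* (P :+ Q) :* ((a :- c) :* (a :- c)) :+ P :* (P :+ Q) :* ((c :- b) :* (c :- b))) refl P Q

    partBound-centres : ∀ {m ℓ} (y : Fin m → Point R D) (f : Fin m → Fin ℓ) (c : Fin m → Point R D) {M} →
                        (∀ a b → f a ≡ f b → c a ≡ c b) → (∀ a → dist² R (y a) (c a) ≤ℝ M) →
                        PartBound R y f (fromℕ 4 * M)
    partBound-centres y f c {M} same-centre close a b fa≡fb = begin
      dist² R (y a) (y b)
        ≡⟨ solve 1 (λ X → X := con (pos 1) :* X) refl _ ⟩
      fromℕ 1 * dist² R (y a) (y b)
        ≤⟨ dist²-triangle-weighted 1 1 (y a) (y b) (c a) ⟩
      fromℕ 2 * dist² R (y a) (c a) + fromℕ 2 * dist² R (c a) (y b)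
        ≤⟨ +-mono-≤ (*-monoʳ-≤-nonneg (fromℕ-nonneg 2) (close a))
                    (*-monoʳ-≤-nonneg (fromℕ-nonneg 2) close-b) ⟩
      fromℕ 2 * M + fromℕ 2 * M
        ≡⟨ solve 1 (λ M → con (pos 2) :* M :+ con (pos 2) :* M := con (pos 4) :* M) refl M ⟩
      fromℕ 4 * M  ∎
      where
      close-b : dist² R (c a) (y b) ≤ℝ M
      close-b = begin
        dist² R (c a) (y b)  ≡⟨ cong (λ z → dist² R z (y b)) (same-centre a b fa≡fb) ⟩
        dist² R (c b) (y b)  ≡⟨ dist²-sym (c b) (y b) ⟩
        dist² R (y b) (c b)  ≤⟨ close b ⟩
        M                    ∎

¬¬-largest : ∀ {m} (P : Fin m → Set) → ∃ P → ¬ ¬ ∃ λ v → P v × (∀ i → P i → i Fin.≤ v)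

¬¬-largest-suc : ∀ {m} (P : Fin (suc m) → Set) → ∃ (P ∘ Fin.suc) →
                 ¬ ¬ ∃ λ v → P v × (∀ i → P i → i Fin.≤ v)

¬¬-largest {suc m} P (Fin.suc i , pi) = ¬¬-largest-suc P (i , pi)
¬¬-largest {suc m} P (Fin.zero , p₀) no-largest = ¬¬-excluded-middle λ where
  (yes P∘suc) → ¬¬-largest-suc P P∘suc no-largest
  (no ¬P∘suc) → no-largest (Fin.zero , p₀ , λ where
    Fin.zero    _  → z≤n
    (Fin.suc i) pi → ⊥-elim (¬P∘suc (i , pi)))

¬¬-largest-suc P P∘suc no-largest = ¬¬-largest (P ∘ Fin.suc) P∘suc λ (v , pv , v-max) →
  no-largest (Fin.suc v , pv , λ where
    Fin.zero    _  → z≤n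
    (Fin.suc i) pi → s≤s (v-max i pi))

inject-< : ∀ {n} {j : Fin n} (b : Fin (toℕ j)) → inject b Fin.< j
inject-< b = subst (ℕ._< _) (sym (FinP.toℕ-inject b)) (FinP.toℕ<n b)

inject-fromℕ< : ∀ {n} {i j : Fin n} (i<j : i Fin.< j) → inject {i = j} (fromℕ< i<j) ≡ i
inject-fromℕ< i<j = FinP.toℕ-injective (trans (FinP.toℕ-inject _) (FinP.toℕ-fromℕ< i<j))

module RunStep (R : RealField) {k n D : ℕ} {x : Fin n → Point R D} (ρ : Run R k n D x) (t : Fin n) where
  open RealField R renaming (_≤_ to _≤ℝ_; _<_ to _<ℝ_; +-mono-≤ to +-monoˡ-≤)
  open IntegerRingSolver R
  open OrderProperties R
  open SumProperties R
  open DistanceProperties R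
  open Run ρ using (kt; kt≤k; asg; sorted)
  open Step R x t (asg t)

  dist²-to-centre : Fin n → Carrier
  dist²-to-centre u = dist² R (x u) (centre (asg t u))

  cost-nonneg : 0# ≤ℝ cost
  cost-nonneg = ∑-nonneg n (λ u → ite-nonneg (u FinP.≤? t) (dist²-nonneg (x u) (centre (asg t u))))

  zero-good : ∀ z → toℕ z ≡ 0 → Good z
  zero-good z z≡0 = begin
    vsum z                  ≡⟨ ∑-cong (kt t) (λ j → ite-zero (j FinP.≤? z) (term-vanishes j)) ⟩
    ∑ R (kt t) (λ _ → 0#)   ≡⟨ ∑-zero (kt t) ⟩
    0#                      ≤⟨ *-nonneg (fromℕ-nonneg 100) cost-nonneg ⟩
    fromℕ 100 * cost        ∎
    where
    below-z : ∀ j → j Fin.≤ z → j ≡ z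
    below-z j j≤z = FinP.toℕ-injective (trans (ℕP.n≤0⇒n≡0 (subst (toℕ j ℕ.≤_) z≡0 j≤z)) (sym z≡0))
    term-vanishes : ∀ j → j Fin.≤ z → size j * dist² R (centre j) (centre z) ≡ 0#
    term-vanishes j j≤z rewrite below-z j j≤z =
      trans (cong (size z *_) (dist²-self (centre z))) (zeroʳ (size z))

  -- Good is not decidable, so v_t exists only under double negation; enough, as we only derive ⊥.
  ¬¬-v : ¬ ¬ ∃ IsV
  ¬¬-v = ¬¬-largest Good (first , zero-good first (FinP.toℕ-fromℕ< 0<kt))
    where
    0<kt : 0 ℕ.< kt t
    0<kt = ℕP.≤-<-trans z≤n (FinP.toℕ<n (asg t t))
    first : Fin (kt t)
    first = fromℕ< 0<kt

  module NonNeighbours {m} (y : Fin m → Fin n)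
                       (y≤t : ∀ b → y b Fin.≤ t) (¬edge : ∀ b → ¬ Edge R ρ t (y b))
                       {v : Fin (kt t)} (isV : IsV v) where

    label : Fin m → Fin (kt t)
    label b = asg t (y b)

    ¬P : ∀ b → ¬ InP (y b)
    ¬P b y∈P = ¬edge b (inj₁ y∈P)

    above-v : ∀ b → v Fin.< label b
    above-v b = ℕP.≰⇒> (λ label≤v → ¬P b (y≤t b , v , isV , label≤v))

    far-from : ∀ w → toℕ w ≡ suc (toℕ v) → ∀ b →
               fromℕ 25 * dist²-to-centre (y b) <ℝ dist² R (x t) (centre w)
    far-from w w≡1+v b = ≰⇒> (λ near → ¬edge b (inj₂ (y≤t b , ¬P b , v , isV , w , w≡1+v , near)))

    part : Fin m → Fin (k ∸ 1)
    part b = fromℕ< (ℕP.<-≤-trans (ℕP.∸-monoˡ-< label<k (above-v b)) (ℕP.∸-monoʳ-≤ k (s≤s z≤n)))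
      where
      label<k : toℕ (label b) ℕ.< k
      label<k = ℕP.<-≤-trans (FinP.toℕ<n (label b)) (kt≤k t)

    part-injective : ∀ a b → part a ≡ part b → label a ≡ label b
    part-injective a b pa≡pb = FinP.toℕ-injective (ℕP.∸-cancelʳ-≡ (above-v a) (above-v b)
      (trans (sym (FinP.toℕ-fromℕ< _)) (trans (cong toℕ pa≡pb) (FinP.toℕ-fromℕ< _))))

    diam²-≤ : ∀ {e M} → IsDiam² R (k ∸ 1) (x ∘ y) e → (∀ b → dist²-to-centre (y b) ≤ℝ M) →
              e ≤ℝ fromℕ 4 * M
    diam²-≤ {M = M} (_ , minimal) close = minimal part (fromℕ 4 * M)
      (partBound-centres (x ∘ y) part (centre ∘ label) (λ a b → cong centre ∘ part-injective a b) close)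

    next<kt : Fin m → suc (toℕ v) ℕ.< kt t
    next<kt a = ℕP.<-≤-trans (s≤s (above-v a)) (FinP.toℕ<n (label a))

    next : Fin m → Fin (kt t)
    next a = fromℕ< (next<kt a)

    -- The clusters are sorted by distance to x_t, and cluster v + 1 comes no later than x's own.
    next-centre-bound : ∀ a → fromℕ 4 * dist² R (x t) (centre (next a)) ≤ℝ
                              fromℕ 20 * dist²-to-centre (y a) + fromℕ 5 * dist² R (x (y a)) (x t)
    next-centre-bound a = begin
      fromℕ 4 * dist² R (x t) (centre (next a))
        ≡⟨ cong (fromℕ 4 *_) (dist²-sym (x t) _) ⟩
      fromℕ 4 * dist² R (centre (next a)) (x t)
        ≤⟨ *-monoʳ-≤-nonneg (fromℕ-nonneg 4) (sorted t _ _ next≤label) ⟩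
      fromℕ 4 * dist² R cₐ (x t)
        ≤⟨ dist²-triangle-weighted 1 4 cₐ (x t) (x (y a)) ⟩
      fromℕ 20 * dist² R cₐ (x (y a)) + fromℕ 5 * dist² R (x (y a)) (x t)
        ≡⟨ cong (λ d → fromℕ 20 * d + _) (dist²-sym cₐ (x (y a))) ⟩
      fromℕ 20 * dist²-to-centre (y a) + fromℕ 5 * dist² R (x (y a)) (x t)  ∎
      where
      cₐ : Point R D
      cₐ = centre (label a)
      next≤label : next a Fin.≤ label a
      next≤label = subst (ℕ._≤ toℕ (label a)) (sym (FinP.toℕ-fromℕ< (next<kt a))) (above-v a)

    not-close : ∀ {e} → IsDiam² R (k ∸ 1) (x ∘ y) e →
                ∀ a → ¬ (dist² R (x (y a)) (x t) ≤ℝ fromℕ 4 * e)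
    not-close {e} diam a close =
      <⇒≱ (far-from (next a) (FinP.toℕ-fromℕ< (next<kt a)) b*)
          (*-cancelˡ-≤-pos (fromℕ-nonneg 4) (fromℕ-suc≢0 3) (begin
            fromℕ 4 * dist² R (x t) (centre (next a))
              ≤⟨ next-centre-bound a ⟩
            fromℕ 20 * dist²-to-centre (y a) + fromℕ 5 * dist² R (x (y a)) (x t)
              ≤⟨ +-mono-≤ (*-monoʳ-≤-nonneg (fromℕ-nonneg 20) (b*-max a))
                          (*-monoʳ-≤-nonneg (fromℕ-nonneg 5) close-a) ⟩
            fromℕ 20 * M + fromℕ 5 * (fromℕ 4 * (fromℕ 4 * M))
              ≡⟨ solve 1 (λ M → con (pos 20) :* M :+ con (pos 5) :* (con (pos 4) :* (con (pos 4) :* M))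
                                := con (pos 4) :* (con (pos 25) :* M)) refl M ⟩
            fromℕ 4 * (fromℕ 25 * M)  ∎))
      where
      b* : Fin m
      b* = proj₁ (argmax a (dist²-to-centre ∘ y))
      M : Carrier
      M = dist²-to-centre (y b*)
      b*-max : ∀ b → dist²-to-centre (y b) ≤ℝ M
      b*-max = proj₂ (argmax a (dist²-to-centre ∘ y))
      close-a : dist² R (x (y a)) (x t) ≤ℝ fromℕ 4 * (fromℕ 4 * M)
      close-a = ≤-trans close (*-monoʳ-≤-nonneg (fromℕ-nonneg 4) (diam²-≤ diam b*-max))

  non-neighbours-separated : ∀ {m} (y : Fin m → Fin n) →
                             (∀ b → y b Fin.≤ t) → (∀ b → ¬ Edge R ρ t (y b)) →
                             ∀ {e} → IsDiam² R (k ∸ 1) (x ∘ y) e →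
                             ∀ a → fromℕ 4 * e <ℝ dist² R (x (y a)) (x t)
  non-neighbours-separated y y≤t ¬edge diam a =
    ≰⇒> λ close → ¬¬-v λ (v , isV) → NonNeighbours.not-close y y≤t ¬edge isV diam a close

lemma7 : (R : RealField) (k n D : ℕ) → 2 ≤ k →
         (x : Fin n → Point R D) →
         (∀ a b → (∀ d → x a d ≡ x b d) → a ≡ b) →
         (ρ : Run R k n D x) →
         (r : ℕ) (idx : Fin r → Fin n) → IndependentSeq R ρ idx →
         BetaKSeq R (RealField._+_ R (RealField.1# R) (RealField.1# R)) k (x ∘ idx)
lemma7 R k n D _ x _ ρ r idx (increasing , independent) j _ e diam i i<j =
  subst₂ _<ℝ_ (four≡2·2 e) (cong (λ i → dist² R (x (idx i)) (x (idx j))) (inject-fromℕ< i<j))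
    (non-neighbours-separated (idx ∘ inject) (λ b → ℕP.<⇒≤ (earlier b)) ¬edge diam (fromℕ< i<j))
  where
  open RealField R renaming (_<_ to _<ℝ_)
  open IntegerRingSolver R
  open RunStep R ρ (idx j)
  four≡2·2 : ∀ e → fromℕ 4 * e ≡ (1# + 1#) * (1# + 1#) * e
  four≡2·2 e = trans (solve 1 (λ e → con (pos 4) :* e := con (pos 2) :* con (pos 2) :* e) refl e)
                     (cong (λ two → two * two * e) (cong (1# +_) (+-identityʳ 1#)))
  earlier : ∀ b → idx (inject b) Fin.< idx j
  earlier b = increasing (inject b) j (inject-< b)
  ¬edge : ∀ b → ¬ Edge R ρ (idx j) (idx (inject b))
  ¬edge b = independent j (inject b) (λ eq → ℕP.<-irrefl (cong toℕ (sym eq)) (earlier b))
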